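{- Let $n\geq 2$ be an integer and $p$ a prime with $p\equiv 1\pmod n$. Let $k$ be a field of characteristic $p$ and $a\in k$. Put $q:=\frac{(n-1)p+(n+1)}{n}$. Then the coefficient of $X^{p-1}$ in the reduction modulo $X^p-X$ of $(X+a)^{(np-(n+1))\frac{p-1}{n}}\in k[X]$ (i.e. in the unique representative of degree $<p$) equals $\binom{q}{2}(a-a^p)^{q-2}$. -}

module Defs where

open import Level using (_⊔_)
open import Algebra.Bundles using (CommutativeRing)
open import Data.Nat using (ℕ; zero; suc; _≤_; _<_)
open import Data.List using (List; []; _∷_)
open import Data.Product using (∃)
open import Relation.Nullary using (¬_)
import Algebra.Definitions.RawMonoid as RM

record IsField {c ℓ} (K : CommutativeRing c ℓ) : Set (c ⊔ ℓ) where
  open CommutativeRing K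
  field
    0≉1     : ¬ (0# ≈ 1#)
    inverse : ∀ x → ¬ (x ≈ 0#) → ∃ λ y → x * y ≈ 1#

record HasCharacteristic {c ℓ} (K : CommutativeRing c ℓ) (p : ℕ) : Set ℓ where
  open CommutativeRing K
  field
    positive : 0 < p
    kills    : RM._×_ +-rawMonoid p 1# ≈ 0#
    least    : ∀ m → 0 < m → RM._×_ +-rawMonoid m 1# ≈ 0# → p ≤ m

-- Univariate polynomials over a commutative ring, as little-endian coefficient
-- lists (trailing zeros allowed; equality is coefficientwise).
module Poly {c ℓ} (K : CommutativeRing c ℓ) where
  open CommutativeRing K

  Pol : Set c
  Pol = List Carrier

  coeff : Pol → ℕ → Carrier
  coeff []       _       = 0#
  coeff (x ∷ f)  zero    = x
  coeff (x ∷ f)  (suc i) = coeff f i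

  infix 4 _≈ₚ_
  _≈ₚ_ : Pol → Pol → Set ℓ
  f ≈ₚ g = ∀ i → coeff f i ≈ coeff g i

  DegreeLess : Pol → ℕ → Set ℓ
  DegreeLess f d = ∀ i → d ≤ i → coeff f i ≈ 0#

  infixl 6 _+ₚ_
  _+ₚ_ : Pol → Pol → Pol
  []      +ₚ g       = g
  (x ∷ f) +ₚ []      = x ∷ f
  (x ∷ f) +ₚ (y ∷ g) = (x + y) ∷ (f +ₚ g)

  scale : Carrier → Pol → Pol
  scale a []      = []
  scale a (x ∷ f) = (a * x) ∷ scale a f

  infixl 7 _*ₚ_
  _*ₚ_ : Pol → Pol → Pol
  []      *ₚ g = []
  (x ∷ f) *ₚ g = scale x g +ₚ (0# ∷ (f *ₚ g))

  constP : Carrier → Pol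
  constP a = a ∷ []

  infixr 8 _^ₚ_
  _^ₚ_ : Pol → ℕ → Pol
  f ^ₚ zero  = constP 1#
  f ^ₚ suc n = f *ₚ (f ^ₚ n)

  mono : Carrier → ℕ → Pol
  mono a zero    = a ∷ []
  mono a (suc m) = 0# ∷ mono a m

  X+ : Carrier → Pol
  X+ a = a ∷ 1# ∷ []

  XpMinusX : ℕ → Pol
  XpMinusX p = mono 1# p +ₚ mono (- 1#) 1

{-# OPTIONS --safe #-}
module Submission where

-- Write p = 1 + m n, P = p − 1 = m n and q = 2 + (n − 1) m, so that the exponent is
-- N = (P − 2) p + q. In characteristic p, (X + a)^p = X^p + b with b = a^p, which is X + b
-- modulo X^p − X; hence (X + a)^N ≡ (X + b)^(P − 2) (X + b + d)^q with d = a − b.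
-- The X^P-coefficient of a remainder modulo X^p − X is the linear form f ↦ Σ_{j ≥ 1} f_{jP},
-- which kills the multiples of X^p − X. On (X + b)^u with u < 2P it takes the value
-- (u choose P) b^(u − P), which in characteristic p is 1 for u = P and 0 otherwise; so after
-- expanding (X + b + d)^q in powers of X + b only the term (q choose 2) d^(q − 2) (X + b)^P counts.

open import Defs
open import Level using (_⊔_)
open import Function using (_∘_)
open import Data.Empty using (⊥-elim)
open import Data.Sum using (inj₁; inj₂)
open import Data.Product using (∃; _,_; proj₁; proj₂)
open import Data.List using ([]; _∷_; length)
open import Data.Nat using (ℕ; zero; suc; _≤_; _<_; s≤s; z≤n; _!; NonZero)
  renaming (_+_ to _+ℕ_; _*_ to _*ℕ_; _∸_ to _∸ℕ_)
import Data.Nat.Properties as ℕ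
open import Data.Nat.DivMod using (_/_; _%_; m/n*n≡m; m*n/n≡m; m≡m%n+[m/n]*n; m<n⇒m%n≡m)
open import Data.Nat.Divisibility
  using (_∣_; _∤_; _∣0; divides; ∣-trans; ∣⇒≤; m∣m*n; m≤n⇒m!∣n!; ∣1⇒≡1)
open import Data.Nat.Combinatorics
  using (_C_; nCn≡1; k>n⇒nCk≡0; nCk+nC[k+1]≡[n+1]C[k+1]; nCk≡n!/k![n-k]!; k![n∸k]!∣n!)
open import Data.Nat.Primality using (Prime; euclidsLemma; ¬prime[1]; prime⇒nonZero)
open import Data.Nat.Tactic.RingSolver using (solve-∀)
open import Algebra.Bundles using (Semiring; CommutativeSemiring; CommutativeRing; CommutativeMonoid)
open import Algebra.Structures using (IsCommutativeMonoid)
open import Algebra.Structures.Biased using (isCommutativeMonoidˡ; isCommutativeSemiringʳ)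
import Algebra.Definitions.RawMonoid
import Algebra.Definitions.RawSemiring
open import Relation.Nullary using (yes; no; contradiction)
open import Relation.Binary.Bundles using (Setoid)
open import Relation.Binary.Definitions using (tri<; tri≈; tri>)
import Relation.Binary.PropositionalEquality as ≡
open ≡ using (_≡_; _≢_)

m≤n⇒m∣n! : ∀ {m n} .⦃ _ : NonZero m ⦄ → m ≤ n → m ∣ n !
m≤n⇒m∣n! {suc m} m≤n = ∣-trans (m∣m*n (m !)) (m≤n⇒m!∣n! m≤n)

p∤m! : ∀ {p m} → Prime p → m < p → p ∤ m !
p∤m! {m = zero}  pr _   p∣1  = ¬prime[1] (≡.subst Prime (∣1⇒≡1 p∣1) pr)
p∤m! {m = suc m} pr m<p p∣m! with euclidsLemma (suc m) (m !) pr p∣m!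
... | inj₁ p∣1+m = ℕ.<⇒≱ m<p (∣⇒≤ p∣1+m)
... | inj₂ p∣m!  = p∤m! pr (ℕ.<-trans (ℕ.n<1+n m) m<p) p∣m!

p∤m!*n! : ∀ {p m n} → Prime p → m < p → n < p → p ∤ m ! *ℕ n !
p∤m!*n! {m = m} {n} pr m<p n<p p∣m!*n! with euclidsLemma (m !) (n !) pr p∣m!*n!
... | inj₁ p∣m! = p∤m! pr m<p p∣m!
... | inj₂ p∣n! = p∤m! pr n<p p∣n!

nCk*[k!*[n∸k]!]≡n! : ∀ {n k} → k ≤ n → (n C k) *ℕ (k ! *ℕ (n ∸ℕ k) !) ≡ n !
nCk*[k!*[n∸k]!]≡n! {n} {k} k≤n =
  ≡.trans (≡.cong (_*ℕ (k ! *ℕ (n ∸ℕ k) !)) (nCk≡n!/k![n-k]! k≤n)) (m/n*n≡m (k![n∸k]!∣n! k≤n))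
  where instance _ = k ℕ.!* (n ∸ℕ k) !≢0

p∣nCk : ∀ {p n k} → Prime p → k < p → n ∸ℕ k < p → p ≤ n → p ∣ n C k
p∣nCk {p} {n} {k} pr k<p n∸k<p p≤n with k ℕ.≤? n
... | no k≰n = ≡.subst (p ∣_) (≡.sym (k>n⇒nCk≡0 (ℕ.≰⇒> k≰n))) (p ∣0)
... | yes k≤n with euclidsLemma (n C k) (k ! *ℕ (n ∸ℕ k) !) pr
  (≡.subst (p ∣_) (≡.sym (nCk*[k!*[n∸k]!]≡n! k≤n)) (m≤n⇒m∣n! ⦃ prime⇒nonZero pr ⦄ p≤n))
...   | inj₁ p∣nCk         = p∣nCk
...   | inj₂ p∣k!*[n∸k]! = ⊥-elim (p∤m!*n! pr k<p n∸k<p p∣k!*[n∸k]!)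

m+[1+n]<o⇒[1+m]+n<o : ∀ {m n o} → m +ℕ suc n < o → suc m +ℕ n < o
m+[1+n]<o⇒[1+m]+n<o {m} {n} {o} = ≡.subst (_< o) (ℕ.+-suc m n)

m+[1+n]<o⇒m+n<o : ∀ {m n o} → m +ℕ suc n < o → m +ℕ n < o
m+[1+n]<o⇒m+n<o {m} {n} = ℕ.≤-<-trans (ℕ.+-monoʳ-≤ m (ℕ.n≤1+n n))

m%n≡1%n⇒m≡1+[m/n]*n : ∀ {m n} .⦃ _ : NonZero n ⦄ → 1 < n → m % n ≡ 1 % n → m ≡ suc (m / n *ℕ n)
m%n≡1%n⇒m≡1+[m/n]*n {m} {n} 1<n m%n≡1%n =
  ≡.trans (m≡m%n+[m/n]*n m n) (≡.cong (_+ℕ m / n *ℕ n) (≡.trans m%n≡1%n (m<n⇒m%n≡m 1<n)))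

module Congruence {c ℓ} (R : CommutativeSemiring c ℓ) where
  open CommutativeSemiring R
  open import Algebra.Properties.CommutativeSemigroup *-commutativeSemigroup using (xy∙z≈xz∙y)
  open import Relation.Binary.Reasoning.Setoid setoid

  infix 4 _≈_mod_
  _≈_mod_ : Carrier → Carrier → Carrier → Set (c ⊔ ℓ)
  _≈_mod_ x y m = ∃ λ s → x ≈ y + s * m

  ≈⇒≈mod : ∀ {m x y} → x ≈ y → x ≈ y mod m
  ≈⇒≈mod {m} {x} {y} x≈y = 0# , (begin
    x          ≈⟨ x≈y ⟩
    y          ≈⟨ +-identityʳ y ⟨
    y + 0#     ≈⟨ +-congˡ (zeroˡ m) ⟨
    y + 0# * m ∎)

  ≈mod-trans : ∀ {m x y z} → x ≈ y mod m → y ≈ z mod m → x ≈ z mod m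
  ≈mod-trans {m} {x} {y} {z} (s , x≈y+sm) (t , y≈z+tm) = t + s , (begin
    x                  ≈⟨ x≈y+sm ⟩
    y + s * m          ≈⟨ +-congʳ y≈z+tm ⟩
    z + t * m + s * m  ≈⟨ +-assoc z _ _ ⟩
    z + (t * m + s * m) ≈⟨ +-congˡ (distribʳ m t s) ⟨
    z + (t + s) * m    ∎)

  *-cong-mod : ∀ {m x x′ y y′} → x ≈ x′ mod m → y ≈ y′ mod m → x * y ≈ x′ * y′ mod m
  *-cong-mod {m} {x} {x′} {y} {y′} (s , x≈) (t , y≈) = x′ * t + s * y , (begin
    x * y                                   ≈⟨ *-congʳ x≈ ⟩
    (x′ + s * m) * y                        ≈⟨ distribʳ y x′ (s * m) ⟩
    x′ * y + s * m * y                      ≈⟨ +-cong (*-congˡ y≈) (xy∙z≈xz∙y s m y) ⟩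
    x′ * (y′ + t * m) + s * y * m           ≈⟨ +-congʳ (distribˡ x′ y′ (t * m)) ⟩
    x′ * y′ + x′ * (t * m) + s * y * m      ≈⟨ +-assoc _ _ _ ⟩
    x′ * y′ + (x′ * (t * m) + s * y * m)    ≈⟨ +-congˡ (+-congʳ (*-assoc x′ t m)) ⟨
    x′ * y′ + (x′ * t * m + s * y * m)      ≈⟨ +-congˡ (distribʳ m (x′ * t) (s * y)) ⟨
    x′ * y′ + (x′ * t + s * y) * m          ∎)

module BinomialTerms {c ℓ} (S : Semiring c ℓ) where
  open Semiring S
  open import Algebra.Definitions.RawMonoid +-rawMonoid using (_×_)
  open import Algebra.Definitions.RawSemiring rawSemiring using (_^_)
  open import Algebra.Properties.Semiring.Mult S using (×-comm-*; ×-homo-+; ×-assoc-*; ×-congʳ)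
  open import Relation.Binary.Reasoning.Setoid setoid

  binomialTerm : Carrier → ℕ → ℕ → Carrier
  binomialTerm x n k = (n C k) × x ^ (n ∸ℕ k)

  binomialTerm≈C×1#*^ : ∀ x n k → binomialTerm x n k ≈ (n C k) × 1# * x ^ (n ∸ℕ k)
  binomialTerm≈C×1#*^ x n k = trans (×-congʳ (n C k) (sym (*-identityˡ _))) (sym (×-assoc-* (n C k) 1# _))

  binomialTerm-pascal : ∀ x n k →
    x * binomialTerm x n (suc k) + binomialTerm x n k ≈ binomialTerm x (suc n) (suc k)
  binomialTerm-pascal x n k = begin
    x * binomialTerm x n (suc k) + binomialTerm x n k   ≈⟨ +-congʳ x*term ⟩
    (n C suc k) × x ^ (n ∸ℕ k) + (n C k) × x ^ (n ∸ℕ k) ≈⟨ ×-homo-+ _ (n C suc k) (n C k) ⟨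
    (n C suc k +ℕ n C k) × x ^ (n ∸ℕ k)                 ≡⟨ ≡.cong (_× x ^ (n ∸ℕ k)) pascal ⟩
    binomialTerm x (suc n) (suc k)                      ∎
    where
    pascal = ≡.trans (ℕ.+-comm (n C suc k) (n C k)) (nCk+nC[k+1]≡[n+1]C[k+1] n k)
    x*term : x * binomialTerm x n (suc k) ≈ (n C suc k) × x ^ (n ∸ℕ k)
    x*term with k ℕ.<? n
    ... | yes k<n = trans (×-comm-* (n C suc k) x _)
                          (reflexive (≡.cong (λ e → (n C suc k) × x ^ e) (≡.sym (ℕ.+-∸-assoc 1 k<n))))
    ... | no k≮n rewrite k>n⇒nCk≡0 (s≤s (ℕ.≮⇒≥ k≮n)) = zeroʳ x

module Polynomials {c ℓ} (K : CommutativeRing c ℓ) where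
  open CommutativeRing K
  open import Algebra.Properties.CommutativeSemigroup +-commutativeSemigroup
    using () renaming (interchange to +-interchange)
  open import Relation.Binary.Reasoning.Setoid setoid
  open Poly K

  -- A record rather than _≈ₚ_ itself, which unfolds to a Π-type and would hide f and g from unification.
  infix 4 _≋_
  record _≋_ (f g : Pol) : Set ℓ where
    constructor coeffwise
    field coeff-≈ : f ≈ₚ g
  open _≋_ public

  ≋-setoid : Setoid c ℓ
  ≋-setoid = record
    { Carrier = Pol
    ; _≈_ = _≋_
    ; isEquivalence = record
      { refl  = coeffwise λ i → refl
      ; sym   = λ f≋g → coeffwise λ i → sym (coeff-≈ f≋g i)
      ; trans = λ f≋g g≋h → coeffwise λ i → trans (coeff-≈ f≋g i) (coeff-≈ g≋h i)
      }
    }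

  open Setoid ≋-setoid public using () renaming (refl to ≋-refl; sym to ≋-sym; trans to ≋-trans)

  ∷-cong : ∀ {x y f g} → x ≈ y → f ≋ g → x ∷ f ≋ y ∷ g
  ∷-cong x≈y f≋g = coeffwise λ { zero → x≈y ; (suc i) → coeff-≈ f≋g i }

  coeff-+ₚ : ∀ f g i → coeff (f +ₚ g) i ≈ coeff f i + coeff g i
  coeff-+ₚ []      g       i       = sym (+-identityˡ _)
  coeff-+ₚ (x ∷ f) []      i       = sym (+-identityʳ _)
  coeff-+ₚ (x ∷ f) (y ∷ g) zero    = refl
  coeff-+ₚ (x ∷ f) (y ∷ g) (suc i) = coeff-+ₚ f g i

  coeff-scale : ∀ a f i → coeff (scale a f) i ≈ a * coeff f i
  coeff-scale a []      i       = sym (zeroʳ a)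
  coeff-scale a (x ∷ f) zero    = refl
  coeff-scale a (x ∷ f) (suc i) = coeff-scale a f i

  +ₚ-cong : ∀ {f f′ g g′} → f ≋ f′ → g ≋ g′ → f +ₚ g ≋ f′ +ₚ g′
  +ₚ-cong {f} {f′} {g} {g′} f≋f′ g≋g′ = coeffwise λ i →
    trans (coeff-+ₚ f g i) (trans (+-cong (coeff-≈ f≋f′ i) (coeff-≈ g≋g′ i)) (sym (coeff-+ₚ f′ g′ i)))

  +ₚ-assoc : ∀ f g h → (f +ₚ g) +ₚ h ≋ f +ₚ (g +ₚ h)
  +ₚ-assoc f g h = coeffwise λ i → trans (coeff-+ₚ (f +ₚ g) h i) (trans (+-congʳ (coeff-+ₚ f g i))
    (trans (+-assoc _ _ _) (sym (trans (coeff-+ₚ f (g +ₚ h) i) (+-congˡ (coeff-+ₚ g h i))))))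

  +ₚ-comm : ∀ f g → f +ₚ g ≋ g +ₚ f
  +ₚ-comm f g = coeffwise λ i → trans (coeff-+ₚ f g i) (trans (+-comm _ _) (sym (coeff-+ₚ g f i)))

  +ₚ-isCommutativeMonoid : IsCommutativeMonoid _≋_ _+ₚ_ []
  +ₚ-isCommutativeMonoid = isCommutativeMonoidˡ record
    { isSemigroup = record
      { isMagma = record { isEquivalence = Setoid.isEquivalence ≋-setoid ; ∙-cong = +ₚ-cong }
      ; assoc   = +ₚ-assoc
      }
    ; identityˡ = λ f → ≋-refl
    ; comm      = +ₚ-comm
    }

  +ₚ-commutativeMonoid : CommutativeMonoid c ℓ
  +ₚ-commutativeMonoid = record { isCommutativeMonoid = +ₚ-isCommutativeMonoid }

  open import Algebra.Properties.CommutativeSemigroup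
    (CommutativeMonoid.commutativeSemigroup +ₚ-commutativeMonoid) using () renaming (interchange to +ₚ-interchange)

  scale-cong : ∀ {a b f g} → a ≈ b → f ≋ g → scale a f ≋ scale b g
  scale-cong {a} {b} {f} {g} a≈b f≋g = coeffwise λ i →
    trans (coeff-scale a f i) (trans (*-cong a≈b (coeff-≈ f≋g i)) (sym (coeff-scale b g i)))

  scale-+ₚ : ∀ a f g → scale a (f +ₚ g) ≋ scale a f +ₚ scale a g
  scale-+ₚ a f g = coeffwise λ i → trans (coeff-scale a (f +ₚ g) i) (trans (*-congˡ (coeff-+ₚ f g i))
    (trans (distribˡ a _ _) (sym (trans (coeff-+ₚ (scale a f) (scale a g) i)
    (+-cong (coeff-scale a f i) (coeff-scale a g i))))))

  scale-0# : ∀ f → scale 0# f ≋ []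
  scale-0# f = coeffwise λ i → trans (coeff-scale 0# f i) (zeroˡ _)

  scale-1# : ∀ f → scale 1# f ≋ f
  scale-1# f = coeffwise λ i → trans (coeff-scale 1# f i) (*-identityˡ _)

  scale-scale : ∀ a b f → scale a (scale b f) ≋ scale (a * b) f
  scale-scale a b f = coeffwise λ i → trans (coeff-scale a (scale b f) i) (trans (*-congˡ (coeff-scale b f i))
    (trans (sym (*-assoc a b _)) (sym (coeff-scale (a * b) f i))))

  *ₚ-congˡ : ∀ f {g h} → g ≋ h → f *ₚ g ≋ f *ₚ h
  *ₚ-congˡ []      g≋h = ≋-refl
  *ₚ-congˡ (x ∷ f) g≋h = +ₚ-cong (scale-cong refl g≋h) (∷-cong refl (*ₚ-congˡ f g≋h))

  *ₚ-zeroʳ : ∀ f → f *ₚ [] ≋ []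
  *ₚ-zeroʳ []      = ≋-refl
  *ₚ-zeroʳ (x ∷ f) = coeffwise λ { zero → refl ; (suc i) → coeff-≈ (*ₚ-zeroʳ f) i }

  *ₚ-distribˡ : ∀ f g h → f *ₚ (g +ₚ h) ≋ f *ₚ g +ₚ f *ₚ h
  *ₚ-distribˡ []      g h = ≋-refl
  *ₚ-distribˡ (x ∷ f) g h = ≋-trans
    (+ₚ-cong (scale-+ₚ x g h) (∷-cong (sym (+-identityʳ 0#)) (*ₚ-distribˡ f g h)))
    (+ₚ-interchange (scale x g) (scale x h) (0# ∷ f *ₚ g) (0# ∷ f *ₚ h))

  *ₚ-constʳ : ∀ f y → f *ₚ constP y ≋ scale y f
  *ₚ-constʳ []      y = ≋-refl
  *ₚ-constʳ (x ∷ f) y = ∷-cong (trans (+-identityʳ _) (*-comm x y)) (*ₚ-constʳ f y)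

  *ₚ-shiftʳ : ∀ f g → f *ₚ (0# ∷ g) ≋ 0# ∷ f *ₚ g
  *ₚ-shiftʳ []      g = coeffwise λ { zero → refl ; (suc i) → refl }
  *ₚ-shiftʳ (x ∷ f) g = ∷-cong (trans (+-identityʳ _) (zeroʳ x)) (+ₚ-cong ≋-refl (*ₚ-shiftʳ f g))

  *ₚ-comm : ∀ f g → f *ₚ g ≋ g *ₚ f
  *ₚ-comm []      g = ≋-sym (*ₚ-zeroʳ g)
  *ₚ-comm (x ∷ f) g = ≋-trans
    (+ₚ-cong (≋-sym (*ₚ-constʳ g x)) (≋-trans (∷-cong refl (*ₚ-comm f g)) (≋-sym (*ₚ-shiftʳ g f))))
    (≋-trans (≋-sym (*ₚ-distribˡ g (constP x) (0# ∷ f))) (*ₚ-congˡ g (∷-cong (+-identityʳ x) ≋-refl)))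

  *ₚ-distribʳ : ∀ f g h → (g +ₚ h) *ₚ f ≋ g *ₚ f +ₚ h *ₚ f
  *ₚ-distribʳ f g h = ≋-trans (*ₚ-comm (g +ₚ h) f)
    (≋-trans (*ₚ-distribˡ f g h) (+ₚ-cong (*ₚ-comm f g) (*ₚ-comm f h)))

  *ₚ-constˡ : ∀ y f → constP y *ₚ f ≋ scale y f
  *ₚ-constˡ y f = ≋-trans (*ₚ-comm (constP y) f) (*ₚ-constʳ f y)

  *ₚ-identityˡ : ∀ f → constP 1# *ₚ f ≋ f
  *ₚ-identityˡ f = ≋-trans (*ₚ-constˡ 1# f) (scale-1# f)

  *ₚ-shiftˡ : ∀ f g → (0# ∷ f) *ₚ g ≋ 0# ∷ f *ₚ g
  *ₚ-shiftˡ f g = +ₚ-cong (scale-0# g) ≋-refl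

  scale-*ₚ : ∀ a f g → scale a f *ₚ g ≋ scale a (f *ₚ g)
  scale-*ₚ a []      g = ≋-refl
  scale-*ₚ a (x ∷ f) g = ≋-trans
    (+ₚ-cong (≋-sym (scale-scale a x g)) (∷-cong (sym (zeroʳ a)) (scale-*ₚ a f g)))
    (≋-sym (scale-+ₚ a (scale x g) (0# ∷ f *ₚ g)))

  *ₚ-assoc : ∀ f g h → (f *ₚ g) *ₚ h ≋ f *ₚ (g *ₚ h)
  *ₚ-assoc []      g h = ≋-refl
  *ₚ-assoc (x ∷ f) g h = ≋-trans (*ₚ-distribʳ h (scale x g) (0# ∷ f *ₚ g))
    (+ₚ-cong (scale-*ₚ x g h) (≋-trans (*ₚ-shiftˡ (f *ₚ g) h) (∷-cong refl (*ₚ-assoc f g h))))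

  *ₚ-cong : ∀ {f f′ g g′} → f ≋ f′ → g ≋ g′ → f *ₚ g ≋ f′ *ₚ g′
  *ₚ-cong {f} {f′} {g} {g′} f≋f′ g≋g′ = ≋-trans (*ₚ-congˡ f g≋g′)
    (≋-trans (*ₚ-comm f g′) (≋-trans (*ₚ-congˡ g′ f≋f′) (*ₚ-comm g′ f′)))

  Pol-commutativeSemiring : CommutativeSemiring c ℓ
  Pol-commutativeSemiring = record
    { 1# = constP 1#
    ; isCommutativeSemiring = isCommutativeSemiringʳ record
      { +-isCommutativeMonoid = +ₚ-isCommutativeMonoid
      ; *-isCommutativeMonoid = isCommutativeMonoidˡ record
        { isSemigroup = record
          { isMagma = record { isEquivalence = Setoid.isEquivalence ≋-setoid ; ∙-cong = *ₚ-cong }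
          ; assoc   = *ₚ-assoc
          }
        ; identityˡ = *ₚ-identityˡ
        ; comm      = *ₚ-comm
        }
      ; distribˡ = *ₚ-distribˡ
      ; zeroʳ    = *ₚ-zeroʳ
      }
    }

  open Congruence Pol-commutativeSemiring public
    renaming (_≈_mod_ to _≋_mod_; ≈⇒≈mod to ≋⇒≋mod; ≈mod-trans to ≋mod-trans; *-cong-mod to *ₚ-cong-mod)

  ^ₚ-homo-*ₚ : ∀ f m n → f ^ₚ (m +ℕ n) ≋ f ^ₚ m *ₚ f ^ₚ n
  ^ₚ-homo-*ₚ f zero    n = ≋-sym (*ₚ-identityˡ (f ^ₚ n))
  ^ₚ-homo-*ₚ f (suc m) n =
    ≋-trans (*ₚ-congˡ f (^ₚ-homo-*ₚ f m n)) (≋-sym (*ₚ-assoc f (f ^ₚ m) (f ^ₚ n)))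

  ^ₚ-assoc : ∀ f m n → f ^ₚ (m *ℕ n) ≋ (f ^ₚ n) ^ₚ m
  ^ₚ-assoc f zero    n = ≋-refl
  ^ₚ-assoc f (suc m) n = ≋-trans (^ₚ-homo-*ₚ f n (m *ℕ n)) (*ₚ-congˡ (f ^ₚ n) (^ₚ-assoc f m n))

  ^ₚ-cong-mod : ∀ {m f g} n → f ≋ g mod m → f ^ₚ n ≋ g ^ₚ n mod m
  ^ₚ-cong-mod zero    f≋g = ≋⇒≋mod ≋-refl
  ^ₚ-cong-mod (suc n) f≋g = *ₚ-cong-mod f≋g (^ₚ-cong-mod n f≋g)

  open BinomialTerms semiring
  open import Algebra.Definitions.RawMonoid +-rawMonoid using (_×_)
  open import Algebra.Definitions.RawSemiring (Semiring.rawSemiring semiring) using (_^_)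
  open import Algebra.Properties.Semiring.Mult semiring using (×-comm-*)
  open import Algebra.Properties.Ring ring using (-1*x≈-x; -0#≈0#)

  coeff-X+-*ₚ : ∀ x g i → coeff (X+ x *ₚ g) i ≈ x * coeff g i + coeff (0# ∷ g) i
  coeff-X+-*ₚ x g i = trans (coeff-≈ (+ₚ-cong {f = scale x g} ≋-refl (∷-cong refl (*ₚ-identityˡ g))) i)
    (trans (coeff-+ₚ (scale x g) (0# ∷ g) i) (+-congʳ (coeff-scale x g i)))

  coeff-X+^ : ∀ x n i → coeff (X+ x ^ₚ n) i ≈ binomialTerm x n i
  coeff-X+^ x zero    zero    = sym (+-identityʳ 1#)
  coeff-X+^ x zero    (suc i) = refl
  coeff-X+^ x (suc n) zero    = begin
    coeff (X+ x *ₚ X+ x ^ₚ n) 0    ≈⟨ coeff-X+-*ₚ x (X+ x ^ₚ n) 0 ⟩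
    x * coeff (X+ x ^ₚ n) 0 + 0#  ≈⟨ +-identityʳ _ ⟩
    x * coeff (X+ x ^ₚ n) 0       ≈⟨ *-congˡ (coeff-X+^ x n 0) ⟩
    x * binomialTerm x n 0        ≈⟨ ×-comm-* 1 x _ ⟩
    binomialTerm x (suc n) 0      ∎
  coeff-X+^ x (suc n) (suc i) = begin
    coeff (X+ x *ₚ X+ x ^ₚ n) (suc i)                    ≈⟨ coeff-X+-*ₚ x (X+ x ^ₚ n) (suc i) ⟩
    x * coeff (X+ x ^ₚ n) (suc i) + coeff (X+ x ^ₚ n) i  ≈⟨ +-cong (*-congˡ (coeff-X+^ x n (suc i))) (coeff-X+^ x n i) ⟩
    x * binomialTerm x n (suc i) + binomialTerm x n i    ≈⟨ binomialTerm-pascal x n i ⟩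
    binomialTerm x (suc n) (suc i)                       ∎

  X+^-degree : ∀ x n → DegreeLess (X+ x ^ₚ n) (suc n)
  X+^-degree x n i n<i =
    trans (coeff-X+^ x n i) (reflexive (≡.cong (_× x ^ (n ∸ℕ i)) (k>n⇒nCk≡0 n<i)))

  coeff-length : ∀ f {i} → length f ≤ i → coeff f i ≡ 0#
  coeff-length []      _         = ≡.refl
  coeff-length (x ∷ f) (s≤s f≤i) = coeff-length f f≤i

  coeff-mono-≡ : ∀ x m → coeff (mono x m) m ≡ x
  coeff-mono-≡ x zero    = ≡.refl
  coeff-mono-≡ x (suc m) = coeff-mono-≡ x m

  coeff-mono-≢ : ∀ x {m i} → i ≢ m → coeff (mono x m) i ≡ 0#
  coeff-mono-≢ x {zero}  {zero}  i≢m = contradiction ≡.refl i≢m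
  coeff-mono-≢ x {zero}  {suc i} i≢m = ≡.refl
  coeff-mono-≢ x {suc m} {zero}  i≢m = ≡.refl
  coeff-mono-≢ x {suc m} {suc i} i≢m = coeff-mono-≢ x (i≢m ∘ ≡.cong suc)

  coeff-mono-*ₚ-< : ∀ x m s {i} → i < m → coeff (mono x m *ₚ s) i ≈ 0#
  coeff-mono-*ₚ-< x (suc m) s {zero}  _         = coeff-≈ (*ₚ-shiftˡ (mono x m) s) 0
  coeff-mono-*ₚ-< x (suc m) s {suc i} (s≤s i<m) =
    trans (coeff-≈ (*ₚ-shiftˡ (mono x m) s) (suc i)) (coeff-mono-*ₚ-< x m s i<m)

  coeff-mono-*ₚ : ∀ x m s i → coeff (mono x m *ₚ s) (m +ℕ i) ≈ x * coeff s i
  coeff-mono-*ₚ x zero    s i = trans (coeff-≈ (*ₚ-constˡ x s) i) (coeff-scale x s i)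
  coeff-mono-*ₚ x (suc m) s i = trans (coeff-≈ (*ₚ-shiftˡ (mono x m) s) (suc (m +ℕ i))) (coeff-mono-*ₚ x m s i)

  coeff-*ₚXpMinusX : ∀ s p i →
    coeff (s *ₚ XpMinusX p) i ≈ coeff (mono 1# p *ₚ s) i + coeff (mono (- 1#) 1 *ₚ s) i
  coeff-*ₚXpMinusX s p i =
    trans (coeff-≈ (≋-trans (*ₚ-comm s (XpMinusX p)) (*ₚ-distribʳ s (mono 1# p) (mono (- 1#) 1))) i)
    (coeff-+ₚ (mono 1# p *ₚ s) (mono (- 1#) 1 *ₚ s) i)

  coeff-*ₚXpMinusX-< : ∀ s {p i} → suc i < p → coeff (s *ₚ XpMinusX p) (suc i) ≈ - coeff s i
  coeff-*ₚXpMinusX-< s {p} {i} 1+i<p = begin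
    coeff (s *ₚ XpMinusX p) (suc i)   ≈⟨ coeff-*ₚXpMinusX s p (suc i) ⟩
    coeff (mono 1# p *ₚ s) (suc i) + coeff (mono (- 1#) 1 *ₚ s) (suc i)
      ≈⟨ +-cong (coeff-mono-*ₚ-< 1# p s 1+i<p) (coeff-mono-*ₚ (- 1#) 1 s i) ⟩
    0# + - 1# * coeff s i             ≈⟨ trans (+-identityˡ _) (-1*x≈-x _) ⟩
    - coeff s i                       ∎

  coeff-*ₚXpMinusX-≥ : ∀ s P i →
    coeff (s *ₚ XpMinusX (suc P)) (suc P +ℕ i) ≈ coeff s i - coeff s (P +ℕ i)
  coeff-*ₚXpMinusX-≥ s P i = begin
    coeff (s *ₚ XpMinusX (suc P)) (suc P +ℕ i)   ≈⟨ coeff-*ₚXpMinusX s (suc P) (suc P +ℕ i) ⟩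
    coeff (mono 1# (suc P) *ₚ s) (suc P +ℕ i) + coeff (mono (- 1#) 1 *ₚ s) (suc P +ℕ i)
      ≈⟨ +-cong (coeff-mono-*ₚ 1# (suc P) s i) (coeff-mono-*ₚ (- 1#) 1 s (P +ℕ i)) ⟩
    1# * coeff s i + - 1# * coeff s (P +ℕ i)     ≈⟨ +-cong (*-identityˡ _) (-1*x≈-x _) ⟩
    coeff s i - coeff s (P +ℕ i)                 ∎

  -- Since X^(i+P) ≡ X^i modulo X^(P+1) − X for i ≥ 1,
  -- this linear form kills the multiples of X^(P+1) − X (periodicSum-mod), so it reads off the
  -- X^P-coefficient of a remainder.
  periodicSum : ℕ → ℕ → Pol → Carrier
  periodicSum P zero    f = coeff f P
  periodicSum P (suc B) f = periodicSum P B f + coeff f (suc (suc B) *ℕ P)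

  periodicSum-cong : ∀ P B {f g} → f ≋ g → periodicSum P B f ≈ periodicSum P B g
  periodicSum-cong P zero    f≋g = coeff-≈ f≋g P
  periodicSum-cong P (suc B) f≋g = +-cong (periodicSum-cong P B f≋g) (coeff-≈ f≋g _)

  periodicSum-+ₚ : ∀ P B f g → periodicSum P B (f +ₚ g) ≈ periodicSum P B f + periodicSum P B g
  periodicSum-+ₚ P zero    f g = coeff-+ₚ f g P
  periodicSum-+ₚ P (suc B) f g =
    trans (+-cong (periodicSum-+ₚ P B f g) (coeff-+ₚ f g _)) (+-interchange _ _ _ _)

  periodicSum-scale : ∀ P B a f → periodicSum P B (scale a f) ≈ a * periodicSum P B f
  periodicSum-scale P zero    a f = coeff-scale a f P
  periodicSum-scale P (suc B) a f =
    trans (+-cong (periodicSum-scale P B a f) (coeff-scale a f _)) (sym (distribˡ a _ _))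

  periodicSum-DegreeLess : ∀ P B {f} → DegreeLess f (P +ℕ P) → periodicSum P B f ≈ coeff f P
  periodicSum-DegreeLess P zero    deg = refl
  periodicSum-DegreeLess P (suc B) deg =
    trans (+-cong (periodicSum-DegreeLess P B deg) (deg _ 2P≤[2+B]P)) (+-identityʳ _)
    where 2P≤[2+B]P = ℕ.+-monoʳ-≤ P (ℕ.m≤m+n P (B *ℕ P))

  periodicSum-*ₚXpMinusX : ∀ P′ B s →
    periodicSum (suc P′) B (s *ₚ XpMinusX (suc (suc P′))) ≈ - coeff s (B *ℕ suc P′ +ℕ P′)
  periodicSum-*ₚXpMinusX P′ zero    s = coeff-*ₚXpMinusX-< s ℕ.≤-refl
  periodicSum-*ₚXpMinusX P′ (suc B) s = begin
    periodicSum P B (s *ₚ M) + coeff (s *ₚ M) (suc (suc B) *ℕ P)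
      ≈⟨ +-cong (periodicSum-*ₚXpMinusX P′ B s)
                (trans (reflexive (≡.cong (coeff (s *ₚ M)) index)) (coeff-*ₚXpMinusX-≥ s P i)) ⟩
    - coeff s i + (coeff s i - coeff s (P +ℕ i))  ≈⟨ sym (+-assoc _ _ _) ⟩
    - coeff s i + coeff s i - coeff s (P +ℕ i)    ≈⟨ +-congʳ (-‿inverseˡ _) ⟩
    0# - coeff s (P +ℕ i)                         ≈⟨ +-identityˡ _ ⟩
    - coeff s (P +ℕ i)                            ≡⟨ ≡.cong (λ j → - coeff s j) (ℕ.+-assoc P (B *ℕ P) P′) ⟨
    - coeff s (suc B *ℕ P +ℕ P′)                  ∎
    where
    P = suc P′
    M = XpMinusX (suc P)
    i = B *ℕ P +ℕ P′
    index : suc (suc B) *ℕ P ≡ suc P +ℕ i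
    index = ≡.cong suc (≡.trans (ℕ.+-suc P′ _) (≡.cong (suc ∘ (P′ +ℕ_)) (ℕ.+-comm P′ (B *ℕ P))))

  periodicSum-mod : ∀ P′ B s {f g} → f ≋ g +ₚ s *ₚ XpMinusX (suc (suc P′)) → length s ≤ B →
                    periodicSum (suc P′) B f ≈ periodicSum (suc P′) B g
  periodicSum-mod P′ B s {f} {g} f≋g+sM len≤B = begin
    periodicSum P B f                             ≈⟨ periodicSum-cong P B f≋g+sM ⟩
    periodicSum P B (g +ₚ s *ₚ M)                 ≈⟨ periodicSum-+ₚ P B g (s *ₚ M) ⟩
    periodicSum P B g + periodicSum P B (s *ₚ M)  ≈⟨ +-congˡ (periodicSum-*ₚXpMinusX P′ B s) ⟩
    periodicSum P B g + - coeff s (B *ℕ P +ℕ P′)  ≡⟨ ≡.cong (λ x → periodicSum P B g + - x) (coeff-length s len≤i) ⟩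
    periodicSum P B g + - 0#                      ≈⟨ trans (+-congˡ -0#≈0#) (+-identityʳ _) ⟩
    periodicSum P B g                             ∎
    where
    P = suc P′
    M = XpMinusX (suc P)
    len≤i = ℕ.≤-trans len≤B (ℕ.≤-trans (ℕ.m≤m*n B P) (ℕ.m≤m+n (B *ℕ P) P′))

module PrimeCharacteristic {c ℓ} (K : CommutativeRing c ℓ) (P′ : ℕ)
  (p-prime : Prime (suc (suc P′))) (char : HasCharacteristic K (suc (suc P′))) where
  open CommutativeRing K
  open Poly K
  open Polynomials K
  open BinomialTerms semiring
  open import Algebra.Definitions.RawMonoid +-rawMonoid using (_×_)
  open import Algebra.Definitions.RawSemiring (Semiring.rawSemiring semiring) using (_^_)
  open import Algebra.Properties.Semiring.Mult semiring using (×-assoc-*; ×-comm-*; ×-assocˡ; ×-congʳ)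
  open import Algebra.Properties.Ring ring using (xyx⁻¹≈y)
  open import Relation.Binary.Reasoning.Setoid setoid

  P p : ℕ
  P = suc P′
  p = suc P

  p×x≈0 : ∀ x → p × x ≈ 0#
  p×x≈0 x = begin
    p × x          ≈⟨ ×-congʳ p (*-identityˡ x) ⟨
    p × (1# * x)   ≈⟨ ×-assoc-* p 1# x ⟨
    (p × 1#) * x   ≈⟨ *-congʳ (HasCharacteristic.kills char) ⟩
    0# * x         ≈⟨ zeroˡ x ⟩
    0#             ∎

  ×-vanishes : ∀ {m} x → p ∣ m → m × x ≈ 0#
  ×-vanishes x (divides t ≡.refl) = begin
    (t *ℕ p) × x   ≡⟨ ≡.cong (_× x) (ℕ.*-comm t p) ⟩
    (p *ℕ t) × x   ≈⟨ ×-assocˡ x p t ⟨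
    p × (t × x)    ≈⟨ p×x≈0 (t × x) ⟩
    0#             ∎

  freshmansDream : ∀ a → X+ a ^ₚ p ≋ mono 1# p +ₚ constP (a ^ p)
  freshmansDream a = coeffwise λ i →
    trans (coeff-X+^ a p i) (sym (trans (coeff-+ₚ (mono 1# p) (constP (a ^ p)) i) (coefficient i)))
    where
    coefficient : ∀ i → coeff (mono 1# p) i + coeff (constP (a ^ p)) i ≈ binomialTerm a p i
    coefficient zero = trans (+-identityˡ _) (sym (+-identityʳ _))
    coefficient (suc j) with ℕ.<-cmp (suc j) p
    ... | tri< j<p j≢p _ = trans (+-identityʳ _) (trans (reflexive (coeff-mono-≢ 1# j≢p))
            (sym (×-vanishes _ (p∣nCk p-prime j<p (s≤s (ℕ.m∸n≤m P j)) ℕ.≤-refl))))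
    ... | tri≈ _ ≡.refl _ rewrite nCn≡1 p | ℕ.n∸n≡0 P′ =
            trans (+-identityʳ _) (trans (reflexive (coeff-mono-≡ 1# p)) (sym (+-identityʳ 1#)))
    ... | tri> _ j≢p p<j rewrite k>n⇒nCk≡0 p<j = trans (+-identityʳ _) (reflexive (coeff-mono-≢ 1# j≢p))

  X+^p≋X+[a^p]-mod : ∀ a → X+ a ^ₚ p ≋ X+ (a ^ p) mod XpMinusX p
  X+^p≋X+[a^p]-mod a = constP 1# , ≋-trans (freshmansDream a)
    (≋-trans X^p+b≋X+b+[X^p-X] (+ₚ-cong {f = X+ (a ^ p)} ≋-refl (≋-sym (*ₚ-identityˡ (XpMinusX p)))))
    where
    -- Since p ≥ 2, both sides are a ^ p ∷ 0# ∷ mono 1# P′ up to ≈, the middle 0# being 1# − 1#.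
    X^p+b≋X+b+[X^p-X] : mono 1# p +ₚ constP (a ^ p) ≋ X+ (a ^ p) +ₚ XpMinusX p
    X^p+b≋X+b+[X^p-X] = ∷-cong (trans (+-comm 0# _) (+-congˡ (sym (+-identityʳ 0#))))
      (∷-cong (sym (trans (+-congˡ (+-identityˡ (- 1#))) (-‿inverseʳ 1#))) (≋-sym (+ₚ-comm (mono 1# P′) [])))

  periodicSum-X+^ : ∀ B x u → u < P +ℕ P → periodicSum P B (X+ x ^ₚ u) ≈ binomialTerm x u P
  periodicSum-X+^ B x u u<2P =
    trans (periodicSum-DegreeLess P B (λ i 2P≤i → X+^-degree x u i (ℕ.<-≤-trans u<2P 2P≤i))) (coeff-X+^ x u P)

  periodicSum-X+^-< : ∀ B x {u} → u < P → periodicSum P B (X+ x ^ₚ u) ≈ 0#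
  periodicSum-X+^-< B x {u} u<P = trans (periodicSum-X+^ B x u (ℕ.<-≤-trans u<P (ℕ.m≤m+n P P)))
    (reflexive (≡.cong (_× x ^ (u ∸ℕ P)) (k>n⇒nCk≡0 u<P)))

  periodicSum-X+^-≡ : ∀ B x {u} → u ≡ P → periodicSum P B (X+ x ^ₚ u) ≈ 1#
  periodicSum-X+^-≡ B x ≡.refl = trans (periodicSum-X+^ B x P (ℕ.m<m+n P (s≤s z≤n)))
    (trans (reflexive (≡.cong₂ (λ m e → m × x ^ e) (nCn≡1 P) (ℕ.n∸n≡0 P))) (+-identityʳ 1#))

  periodicSum-X+^-> : ∀ B x {u} → P < u → u < P +ℕ P → periodicSum P B (X+ x ^ₚ u) ≈ 0#
  periodicSum-X+^-> B x {u} P<u u<2P = trans (periodicSum-X+^ B x u u<2P)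
    (×-vanishes _ (p∣nCk p-prime (ℕ.n<1+n P) u∸P<p P<u))
    where u∸P<p = ℕ.m<n⇒m<1+n (ℕ.m<n+o⇒m∸n<o u P u<2P)

  module _ (a : Carrier) where
    d : Carrier
    d = a - a ^ p

    Y A : Pol
    Y = X+ (a ^ p)
    A = X+ a

    A≋Y+d : A ≋ Y +ₚ constP d
    A≋Y+d = ∷-cong (sym (trans (sym (+-assoc (a ^ p) a (- a ^ p))) (xyx⁻¹≈y (a ^ p) a))) ≋-refl

    Y^u*A^[1+v] : ∀ u v → Y ^ₚ u *ₚ A ^ₚ suc v ≋ Y ^ₚ suc u *ₚ A ^ₚ v +ₚ scale d (Y ^ₚ u *ₚ A ^ₚ v)
    Y^u*A^[1+v] u v =
      ≋-trans (*ₚ-congˡ F (*ₚ-cong A≋Y+d ≋-refl)) (≋-trans (*ₚ-congˡ F (*ₚ-distribʳ G Y (constP d)))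
      (≋-trans (*ₚ-distribˡ F (Y *ₚ G) (constP d *ₚ G)) (+ₚ-cong F*[Y*G]≋[Y*F]*G F*[d*G]≋d*[F*G])))
      where
      F = Y ^ₚ u
      G = A ^ₚ v
      F*[Y*G]≋[Y*F]*G = ≋-trans (≋-sym (*ₚ-assoc F Y G)) (*ₚ-cong (*ₚ-comm F Y) ≋-refl)
      F*[d*G]≋d*[F*G] = ≋-trans (*ₚ-congˡ F (*ₚ-constˡ d G))
        (≋-trans (*ₚ-comm F (scale d G)) (≋-trans (scale-*ₚ d G F) (scale-cong refl (*ₚ-comm G F))))

    periodicSum-Y^u*A^[1+v] : ∀ B u v → periodicSum P B (Y ^ₚ u *ₚ A ^ₚ suc v) ≈
      periodicSum P B (Y ^ₚ suc u *ₚ A ^ₚ v) + d * periodicSum P B (Y ^ₚ u *ₚ A ^ₚ v)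
    periodicSum-Y^u*A^[1+v] B u v = trans (periodicSum-cong P B (Y^u*A^[1+v] u v))
      (trans (periodicSum-+ₚ P B _ _) (+-congˡ (periodicSum-scale P B d _)))

    periodicSum-Y^u*A^0 : ∀ B u → periodicSum P B (Y ^ₚ u *ₚ A ^ₚ 0) ≈ periodicSum P B (Y ^ₚ u)
    periodicSum-Y^u*A^0 B u = periodicSum-cong P B (≋-trans (*ₚ-constʳ (Y ^ₚ u) 1#) (scale-1# (Y ^ₚ u)))

    periodicSum-Y^u*A^v-vanishes : ∀ B v {u} → P < u → u +ℕ v < P +ℕ P →
                                   periodicSum P B (Y ^ₚ u *ₚ A ^ₚ v) ≈ 0#
    periodicSum-Y^u*A^v-vanishes B zero    {u} P<u u+0<2P = trans (periodicSum-Y^u*A^0 B u)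
      (periodicSum-X+^-> B (a ^ p) P<u (ℕ.≤-<-trans (ℕ.m≤m+n u 0) u+0<2P))
    periodicSum-Y^u*A^v-vanishes B (suc v) {u} P<u u+1+v<2P = begin
      periodicSum P B (Y ^ₚ u *ₚ A ^ₚ suc v)  ≈⟨ periodicSum-Y^u*A^[1+v] B u v ⟩
      periodicSum P B (Y ^ₚ suc u *ₚ A ^ₚ v) + d * periodicSum P B (Y ^ₚ u *ₚ A ^ₚ v)
        ≈⟨ +-cong (periodicSum-Y^u*A^v-vanishes B v (ℕ.m<n⇒m<1+n P<u) (m+[1+n]<o⇒[1+m]+n<o u+1+v<2P))
                  (*-congˡ (periodicSum-Y^u*A^v-vanishes B v P<u (m+[1+n]<o⇒m+n<o u+1+v<2P))) ⟩
      0# + d * 0#                             ≈⟨ trans (+-identityˡ _) (zeroʳ d) ⟩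
      0#                                      ∎

    periodicSum-Y^u*A^v : ∀ B v {u w} → u +ℕ w ≡ P → u +ℕ v < P +ℕ P →
                          periodicSum P B (Y ^ₚ u *ₚ A ^ₚ v) ≈ binomialTerm d v w
    periodicSum-Y^u*A^v B zero {u} {zero} u+0≡P _ = trans (periodicSum-Y^u*A^0 B u)
      (trans (periodicSum-X+^-≡ B (a ^ p) (≡.trans (≡.sym (ℕ.+-identityʳ u)) u+0≡P)) (sym (+-identityʳ 1#)))
    periodicSum-Y^u*A^v B zero {u} {suc w} u+1+w≡P _ = trans (periodicSum-Y^u*A^0 B u)
      (periodicSum-X+^-< B (a ^ p) (≡.subst (u <_) u+1+w≡P (ℕ.m<m+n u (s≤s z≤n))))
    periodicSum-Y^u*A^v B (suc v) {u} {zero} u+0≡P u+1+v<2P = begin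
      periodicSum P B (Y ^ₚ u *ₚ A ^ₚ suc v)  ≈⟨ periodicSum-Y^u*A^[1+v] B u v ⟩
      periodicSum P B (Y ^ₚ suc u *ₚ A ^ₚ v) + d * periodicSum P B (Y ^ₚ u *ₚ A ^ₚ v)
        ≈⟨ +-cong (periodicSum-Y^u*A^v-vanishes B v P<1+u (m+[1+n]<o⇒[1+m]+n<o u+1+v<2P))
                  (*-congˡ (periodicSum-Y^u*A^v B v u+0≡P (m+[1+n]<o⇒m+n<o u+1+v<2P))) ⟩
      0# + d * binomialTerm d v 0             ≈⟨ trans (+-identityˡ _) (×-comm-* 1 d _) ⟩
      binomialTerm d (suc v) 0                ∎
      where P<1+u = s≤s (ℕ.≤-reflexive (≡.trans (≡.sym u+0≡P) (ℕ.+-identityʳ u)))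
    periodicSum-Y^u*A^v B (suc v) {u} {suc w} u+1+w≡P u+1+v<2P = begin
      periodicSum P B (Y ^ₚ u *ₚ A ^ₚ suc v)  ≈⟨ periodicSum-Y^u*A^[1+v] B u v ⟩
      periodicSum P B (Y ^ₚ suc u *ₚ A ^ₚ v) + d * periodicSum P B (Y ^ₚ u *ₚ A ^ₚ v)
        ≈⟨ +-cong (periodicSum-Y^u*A^v B v (≡.trans (≡.sym (ℕ.+-suc u w)) u+1+w≡P)
                                            (m+[1+n]<o⇒[1+m]+n<o u+1+v<2P))
                  (*-congˡ (periodicSum-Y^u*A^v B v u+1+w≡P (m+[1+n]<o⇒m+n<o u+1+v<2P))) ⟩
      binomialTerm d v w + d * binomialTerm d v (suc w)  ≈⟨ +-comm _ _ ⟩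
      d * binomialTerm d v (suc w) + binomialTerm d v w  ≈⟨ binomialTerm-pascal d v w ⟩
      binomialTerm d (suc v) (suc w)          ∎

  coeff-remainder-X+^ : ∀ a t v w s r → t +ℕ w ≡ P → t +ℕ v < P +ℕ P → DegreeLess r p →
    X+ a ^ₚ (t *ℕ p +ℕ v) ≈ₚ s *ₚ XpMinusX p +ₚ r → coeff r P ≈ binomialTerm (a - a ^ p) v w
  coeff-remainder-X+^ a t v w s r t+w≡P t+v<2P deg A^N≈sM+r = begin
    coeff r P                               ≈⟨ periodicSum-DegreeLess P B deg′ ⟨
    periodicSum P B r                       ≈⟨ periodicSum-mod P′ B s A^N≋r+sM (ℕ.m≤m+n _ _) ⟨
    periodicSum P B (X+ a ^ₚ N)             ≈⟨ periodicSum-mod P′ B s′ A^N≋Y^tA^v+s′M (ℕ.m≤n+m _ _) ⟩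
    periodicSum P B (Y a ^ₚ t *ₚ A a ^ₚ v)  ≈⟨ periodicSum-Y^u*A^v a B v t+w≡P t+v<2P ⟩
    binomialTerm (d a) v w                  ∎
    where
    N = t *ℕ p +ℕ v
    A^N≋Y^tA^v : X+ a ^ₚ N ≋ Y a ^ₚ t *ₚ A a ^ₚ v mod XpMinusX p
    A^N≋Y^tA^v = ≋mod-trans
      (≋⇒≋mod (≋-trans (^ₚ-homo-*ₚ (X+ a) (t *ℕ p) v) (*ₚ-cong (^ₚ-assoc (X+ a) t p) ≋-refl)))
      (*ₚ-cong-mod (^ₚ-cong-mod t (X+^p≋X+[a^p]-mod a)) (≋⇒≋mod ≋-refl))
    s′ = proj₁ A^N≋Y^tA^v
    A^N≋Y^tA^v+s′M = proj₂ A^N≋Y^tA^v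
    B = length s +ℕ length s′
    A^N≋r+sM : X+ a ^ₚ N ≋ r +ₚ s *ₚ XpMinusX p
    A^N≋r+sM = ≋-trans (coeffwise A^N≈sM+r) (+ₚ-comm _ r)
    deg′ : DegreeLess r (P +ℕ P)
    deg′ i 2P≤i = deg i (ℕ.≤-trans (s≤s (ℕ.m≤n+m P P′)) 2P≤i)

-- n = 2 + n″ and m = 1 + m′, so that the truncated subtractions and divisions of the statement compute.
module Exponents (n″ m′ : ℕ) where
  n m P p t q : ℕ
  n = 2 +ℕ n″
  m = suc m′
  P = m *ℕ n
  p = suc P
  t = P ∸ℕ 2
  q = 2 +ℕ (n ∸ℕ 1) *ℕ m

  q≡ : ((n ∸ℕ 1) *ℕ p +ℕ (n +ℕ 1)) / n ≡ q
  q≡ = ≡.trans (≡.cong (_/ n) ([n-1]p+n+1≡qn n″ m′)) (m*n/n≡m q n)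
    where
    [n-1]p+n+1≡qn : ∀ n″ m′ → let n = 2 +ℕ n″; m = suc m′ in
      suc n″ *ℕ suc (m *ℕ n) +ℕ (n +ℕ 1) ≡ (2 +ℕ suc n″ *ℕ m) *ℕ n
    [n-1]p+n+1≡qn = solve-∀

  N≡ : (n *ℕ p ∸ℕ (n +ℕ 1)) *ℕ ((p ∸ℕ 1) / n) ≡ t *ℕ p +ℕ q
  N≡ = ≡.trans (≡.cong₂ _*ℕ_ np∸[n+1]≡nP∸1 (m*n/n≡m m n)) ([nP-1]m≡tp+q n″ m′)
    where
    [nP-1]+[n+1]≡np : ∀ n″ m′ → let n = 2 +ℕ n″; t = n″ +ℕ m′ *ℕ n; P = 2 +ℕ t in
      suc (t +ℕ suc n″ *ℕ P) +ℕ (n +ℕ 1) ≡ n *ℕ suc P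
    [nP-1]+[n+1]≡np = solve-∀
    [nP-1]m≡tp+q : ∀ n″ m′ → let n = 2 +ℕ n″; m = suc m′; t = n″ +ℕ m′ *ℕ n; P = 2 +ℕ t in
      suc (t +ℕ suc n″ *ℕ P) *ℕ m ≡ t *ℕ suc P +ℕ (2 +ℕ suc n″ *ℕ m)
    [nP-1]m≡tp+q = solve-∀
    np∸[n+1]≡nP∸1 : n *ℕ p ∸ℕ (n +ℕ 1) ≡ n *ℕ P ∸ℕ 1
    np∸[n+1]≡nP∸1 =
      ≡.trans (≡.cong (_∸ℕ (n +ℕ 1)) (≡.sym ([nP-1]+[n+1]≡np n″ m′))) (ℕ.m+n∸n≡m _ (n +ℕ 1))

  t+q<P+P : t +ℕ q < P +ℕ P
  t+q<P+P = ℕ.≤-trans (ℕ.m≤m+n (suc (t +ℕ q)) m′) (ℕ.≤-reflexive (1+t+q+m′≡P+P n″ m′))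
    where
    1+t+q+m′≡P+P : ∀ n″ m′ → let n = 2 +ℕ n″; m = suc m′; t = n″ +ℕ m′ *ℕ n; P = 2 +ℕ t in
      suc (t +ℕ (2 +ℕ suc n″ *ℕ m)) +ℕ m′ ≡ P +ℕ P
    1+t+q+m′≡P+P = solve-∀

lemma2p10 : ∀ {c ℓ} (n p : ℕ) ⦃ _ : NonZero n ⦄ → 2 ≤ n → Prime p → p % n ≡ 1 % n →
    (K : CommutativeRing c ℓ) → IsField K → HasCharacteristic K p →
    let q = ((n ∸ℕ 1) *ℕ p +ℕ (n +ℕ 1)) / n
        N = (n *ℕ p ∸ℕ (n +ℕ 1)) *ℕ ((p ∸ℕ 1) / n)
        open CommutativeRing K
        open Algebra.Definitions.RawMonoid +-rawMonoid using (_×_)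
        open Algebra.Definitions.RawSemiring (Semiring.rawSemiring semiring) using (_^_)
        open Poly K
    in (a : Carrier) (s r : Pol) → DegreeLess r p →
       X+ a ^ₚ N ≈ₚ s *ₚ XpMinusX p +ₚ r →
       coeff r (p ∸ℕ 1) ≈ (q C 2) × 1# * (a - a ^ p) ^ (q ∸ℕ 2)
lemma2p10 n@(suc (suc n″)) p 2≤n@(s≤s (s≤s z≤n)) p-prime p%n≡1%n K _ char a s r deg A^N≈sM+r
  with p / n | m%n≡1%n⇒m≡1+[m/n]*n {p} 2≤n p%n≡1%n
... | zero   | ≡.refl = ⊥-elim (¬prime[1] p-prime)
... | suc m′ | ≡.refl = ≡.subst (λ q′ → coeff r P ≈ (q′ C 2) × 1# * (a - a ^ p) ^ (q′ ∸ℕ 2)) (≡.sym q≡) (begin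
    coeff r P                              ≈⟨ coeff-remainder-X+^ a t q 2 s r (ℕ.+-comm t 2) t+q<P+P deg A^[tp+q]≈sM+r ⟩
    binomialTerm (a - a ^ p) q 2           ≈⟨ binomialTerm≈C×1#*^ (a - a ^ p) q 2 ⟩
    (q C 2) × 1# * (a - a ^ p) ^ (q ∸ℕ 2)  ∎)
  where
  open Exponents n″ m′ using (t; q; P; q≡; N≡; t+q<P+P)
  open CommutativeRing K
  open Poly K
  open PrimeCharacteristic K (suc t) p-prime char using (coeff-remainder-X+^)
  open BinomialTerms semiring using (binomialTerm; binomialTerm≈C×1#*^)
  open Algebra.Definitions.RawMonoid +-rawMonoid using (_×_)
  open Algebra.Definitions.RawSemiring (Semiring.rawSemiring semiring) using (_^_)
  open import Relation.Binary.Reasoning.Setoid setoid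

  A^[tp+q]≈sM+r : X+ a ^ₚ (t *ℕ p +ℕ q) ≈ₚ s *ₚ XpMinusX p +ₚ r
  A^[tp+q]≈sM+r = ≡.subst (λ N → X+ a ^ₚ N ≈ₚ s *ₚ XpMinusX p +ₚ r) N≡ A^N≈sM+r
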